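{- Let $k$ be a field and let $M$ be a regular matroid of rank $r$ on ground set $E(M)=\{e_1,\ldots,e_n\}$. Let $B$ be a basis of $M$, and let $\widetilde{\mathcal{A}}_M(\mathcal{C})$ and $\widetilde{\mathcal{A}}_M(\mathcal{C}^*)$ be compatibly signed circuit and cocircuit incidence matrices of $M$ over $k$. Let $\widetilde{\mathcal{A}}_M^B(\mathcal{C})$ and $\widetilde{\mathcal{A}}_M^B(\mathcal{C}^*)$ be the submatrices consisting of the rows indexed by the fundamental circuits, respectively fundamental cocircuits, of $M$ with respect to $B$. Then over $k$, \[\mathrm{rank}\,\widetilde{\mathcal{A}}_M^B(\mathcal{C})=\mathrm{rank}\,\widetilde{\mathcal{A}}_M(\mathcal{C})=n-r \quad\text{and}\quad \mathrm{rank}\,\widetilde{\mathcal{A}}_M^B(\mathcal{C}^*)=\mathrm{rank}\,\widetilde{\mathcal{A}}_M(\mathcal{C}^*)=r.\]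
   Context: For a basis $B$ of a matroid $M$ and $e\notin B$, the fundamental circuit $\mathrm{ci}(B,e)$ is the unique circuit contained in $B\cup\{e\}$ (it contains $e$); for $b\in B$, the fundamental cocircuit $\mathrm{coc}(B,b)$ is the unique cocircuit (circuit of the dual matroid) contained in $(E(M)\setminus B)\cup\{b\}$ (it contains $b$). The circuit incidence matrix $\mathcal{A}_M(\mathcal{C})$ has rows indexed by all circuits of $M$, columns indexed by $e_1,\ldots,e_n$, and entry $1$ if $e_j$ lies in the circuit and $0$ otherwise; the cocircuit incidence matrix $\mathcal{A}_M(\mathcal{C}^*)$ is defined in the same way with all cocircuits of $M$ as rows. A signing of such a matrix replaces some of its entries $1$ by $-1$. Signings $\widetilde{\mathcal{A}}_M(\mathcal{C})$ and $\widetilde{\mathcal{A}}_M(\mathcal{C}^*)$ are compatible over $k$ if $\widetilde{\mathcal{A}}_M(\mathcal{C})\cdot\widetilde{\mathcal{A}}_M(\mathcal{C}^*)^T=0$ over $k$. A matroid is regular if it is representable by a matrix all of whose square submatrices have determinant in $\{ -1,0,1\}$. -}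

module Defs where

open import Level using (Level; _⊔_) renaming (suc to lsuc)
open import Data.Nat using (ℕ; zero; suc; _<_)
open import Data.Bool using (Bool; true; false; if_then_else_)
open import Data.Fin using (Fin; zero; suc; punchIn)
open import Data.Vec using (lookup)
open import Data.Fin.Subset using (Subset; _∈_; _∉_; _⊆_; _∪_; _∩_; ∁; ⁅_⁆; ∣_∣; ⊥; _-_)
open import Data.Product using (Σ; ∃; _×_; _,_)
open import Data.Integer as ℤ using (ℤ)
open import Data.Rational as ℚ using (ℚ)
open import Relation.Nullary using (¬_)
open import Relation.Binary.PropositionalEquality using (_≡_)
open import Algebra.Bundles using (CommutativeRing)

record Field (c ℓ : Level) : Set (lsuc (c ⊔ ℓ)) where
  field
    commRing : CommutativeRing c ℓ
  open CommutativeRing commRing public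
  field
    0≉1     : ¬ (0# ≈ 1#)
    inverse : ∀ x → ¬ (x ≈ 0#) → Σ Carrier (λ y → x * y ≈ 1#)

module LinAlg {c ℓ} (K : Field c ℓ) where
  open Field K using (Carrier; _≈_; _+_; _*_; -_; 0#; 1#)

  sumFin : ∀ {m} → (Fin m → Carrier) → Carrier
  sumFin {zero}  f = 0#
  sumFin {suc m} f = f zero + sumFin (λ i → f (suc i))

  LinIndep : ∀ {m n} → (Fin m → Fin n → Carrier) → Set (c ⊔ ℓ)
  LinIndep {m} {n} w =
    ∀ (a : Fin m → Carrier) →
      (∀ j → sumFin (λ i → a i * w i j) ≈ 0#) → ∀ i → a i ≈ 0#

  HasRank : ∀ {a} {I : Set a} {n} → (I → Fin n → Carrier) → ℕ → Set (a ⊔ c ⊔ ℓ)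
  HasRank {I = I} v d =
    Σ (Fin d → I) (λ f → LinIndep (λ i → v (f i)))
    × (∀ (g : Fin (suc d) → I) → ¬ LinIndep (λ i → v (g i)))

record Matroid (n : ℕ) : Set₁ where
  field
    Indep       : Subset n → Set
    indep-∅     : Indep ⊥
    indep-⊆     : ∀ {X Y} → X ⊆ Y → Indep Y → Indep X
    indep-aug   : ∀ {X Y} → Indep X → Indep Y → ∣ X ∣ < ∣ Y ∣ →
                  Σ (Fin n) (λ e → e ∈ Y × e ∉ X × Indep (X ∪ ⁅ e ⁆))

module _ {n : ℕ} (M : Matroid n) where
  open Matroid M

  IsBasis : Subset n → Set
  IsBasis B = Indep B × (∀ X → B ⊆ X → Indep X → X ⊆ B)

  HasMatroidRank : ℕ → Set
  HasMatroidRank r = Σ (Subset n) (λ B → IsBasis B × ∣ B ∣ ≡ r)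

  IsCircuit : Subset n → Set
  IsCircuit C = ¬ Indep C × (∀ X → X ⊆ C → ¬ Indep X → C ⊆ X)

  IndepDual : Subset n → Set
  IndepDual X = Σ (Subset n) (λ B → IsBasis B × (X ∩ B) ≡ ⊥)

  IsCocircuit : Subset n → Set
  IsCocircuit D = ¬ IndepDual D × (∀ X → X ⊆ D → ¬ IndepDual X → D ⊆ X)

  Circuit : Set
  Circuit = Σ (Subset n) IsCircuit

  Cocircuit : Set
  Cocircuit = Σ (Subset n) IsCocircuit

  IsFundCircuit : Subset n → Circuit → Set
  IsFundCircuit B (C , _) = Σ (Fin n) (λ e → e ∉ B × C ⊆ (B ∪ ⁅ e ⁆))

  IsFundCocircuit : Subset n → Cocircuit → Set
  IsFundCocircuit B (D , _) = Σ (Fin n) (λ b → b ∈ B × D ⊆ (∁ B ∪ ⁅ b ⁆))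

  FundCircuit : Subset n → Set
  FundCircuit B = Σ Circuit (IsFundCircuit B)

  FundCocircuit : Subset n → Set
  FundCocircuit B = Σ Cocircuit (IsFundCocircuit B)

sumℤ : ∀ {m} → (Fin m → ℤ) → ℤ
sumℤ {zero}  f = ℤ.0ℤ
sumℤ {suc m} f = f zero ℤ.+ sumℤ (λ i → f (suc i))

signℤ : ∀ {m} → Fin m → ℤ
signℤ zero    = ℤ.1ℤ
signℤ (suc i) = ℤ.- signℤ i

det : ∀ {t} → (Fin t → Fin t → ℤ) → ℤ
det {zero}  A = ℤ.1ℤ
det {suc t} A =
  sumℤ (λ j → signℤ j ℤ.* (A zero j ℤ.* det (λ i k → A (suc i) (punchIn j k))))

-- every square submatrix has determinant in {-1,0,1}
-- (rows and columns chosen by injective maps; reordering only changes sign)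
TotallyUnimodular : ∀ {m n} → (Fin m → Fin n → ℤ) → Set
TotallyUnimodular {m} {n} A =
  ∀ t (f : Fin t → Fin m) (g : Fin t → Fin n) →
    (∀ i j → f i ≡ f j → i ≡ j) → (∀ i j → g i ≡ g j → i ≡ j) →
    let d = det (λ i j → A (f i) (g j)) in
    (d ≡ ℤ.-1ℤ) Data.Sum.⊎ ((d ≡ ℤ.0ℤ) Data.Sum.⊎ (d ≡ ℤ.1ℤ))
  where import Data.Sum

sumℚ : ∀ {m} → (Fin m → ℚ) → ℚ
sumℚ {zero}  f = ℚ.0ℚ
sumℚ {suc m} f = f zero ℚ.+ sumℚ (λ i → f (suc i))

ColumnsIndepℚ : ∀ {m n} → (Fin m → Fin n → ℤ) → Subset n → Set
ColumnsIndepℚ {m} {n} A X =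
  ∀ (a : Fin n → ℚ) → (∀ j → j ∉ X → a j ≡ ℚ.0ℚ) →
    (∀ i → sumℚ (λ j → a j ℚ.* (A i j ℚ./ 1)) ≡ ℚ.0ℚ) → ∀ j → a j ≡ ℚ.0ℚ

Represents : ∀ {m n} → (Fin m → Fin n → ℤ) → Matroid n → Set
Represents A M = ∀ X → (Matroid.Indep M X → ColumnsIndepℚ A X)
                     × (ColumnsIndepℚ A X → Matroid.Indep M X)

IsRegular : ∀ {n} → Matroid n → Set
IsRegular {n} M = Σ ℕ (λ m → Σ (Fin m → Fin n → ℤ) (λ A →
                    TotallyUnimodular A × Represents A M))

-- Signed incidence matrices over a field K.  A signing of a family of
-- subsets is a choice of sign (true = -1) for each entry; entries
-- outside the subset are 0.

module Signed {c ℓ} (K : Field c ℓ) where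
  open Field K using (Carrier; _≈_; _+_; _*_; -_; 0#; 1#)
  open LinAlg K public

  signedRow : ∀ {n} → Subset n → (Fin n → Bool) → Fin n → Carrier
  signedRow S σ j = if lookup S j then (if σ j then - 1# else 1#) else 0#

  module _ {n : ℕ} (M : Matroid n) where

    -- a signing assigns signs to the entries of the row of each subset
    -- (only the rows of (co)circuits are used); it depends only on the
    -- subset itself, so each circuit has exactly one signed row.
    Signing : Set
    Signing = Subset n → Fin n → Bool

    CoSigning : Set
    CoSigning = Subset n → Fin n → Bool

    circMatrix : Signing → Circuit M → Fin n → Carrier
    circMatrix σ C = signedRow (Data.Product.proj₁ C) (σ (Data.Product.proj₁ C))
      where import Data.Product

    cocircMatrix : CoSigning → Cocircuit M → Fin n → Carrier
    cocircMatrix τ D = signedRow (Data.Product.proj₁ D) (τ (Data.Product.proj₁ D))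
      where import Data.Product

    Compatible : Signing → CoSigning → Set ℓ
    Compatible σ τ = ∀ C D →
      sumFin (λ j → circMatrix σ C j * cocircMatrix τ D j) ≈ 0#

    fundCircMatrix : Signing → (B : Subset n) → FundCircuit M B → Fin n → Carrier
    fundCircMatrix σ B (C , _) = circMatrix σ C

    fundCocircMatrix : CoSigning → (B : Subset n) → FundCocircuit M B → Fin n → Carrier
    fundCocircMatrix τ B (D , _) = cocircMatrix τ D

-- The heart of the proof is a statement of pure linear algebra
-- ('orthogonal-rank'): let S, T cover the coordinates, let the rows v be
-- orthogonal to the rows w, suppose that for each e ∈ T some row of v has a
-- unit entry at e and vanishes on the rest of T, and that for each s ∈ S some
-- row of w has a unit entry at s and vanishes on the rest of S.  Then the
-- pivot rows chosen for T are independent (they are diagonal on T), and every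
-- row of v is their combination (the residual vanishes on T by diagonality and
-- on S because it is orthogonal to the test rows of w), so v has rank ∣ T ∣.
-- The upper bound is the Steinitz inequality, proved by Gaussian elimination.
--
-- The matroid supplies the hypotheses: for a basis B, the fundamental circuit
-- of e ∉ B meets ∁ B exactly in e and the fundamental cocircuit of b ∈ B meets
-- B exactly in b; signed incidence rows have entries ±1 on their support.
-- Compatibility of the signings is exactly the orthogonality of the circuit
-- rows to the cocircuit rows.  Regularity is used only to decide independence
-- (over ℚ), which makes the fundamental circuits and cocircuits constructible
-- as minimal (co)dependent sets.
module Submission where

open import Defs
open import Level using (Level; _⊔_; 0ℓ)
open import Data.Nat as ℕ using (ℕ; zero; suc; _≤_; s≤s; _∸_)
import Data.Nat.Properties as ℕP
open import Data.Fin using (Fin; zero; suc)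
import Data.Fin.Properties as FinP
open import Data.Fin.Subset
  using (Subset; _∈_; _∉_; _⊆_; _⊂_; _∪_; _∩_; ∁; ∣_∣; ⊤; ⊥; ⁅_⁆; Empty; inside; outside)
  renaming (_-_ to _∖_)
open import Data.Fin.Subset.Properties
  using (_∈?_; _⊆?_; _⊂?_; anySubset?; nonempty?; Empty-unique; ∣⊥∣≡0; ∣⊤∣≡n; p─⊥≡p; ∉⊥;
         x∈⁅x⁆; x∈⁅y⁆⇒x≡y; p⊆p∪q; q⊆p∪q; x∈p∪q⁻; x∈p∩q⁺; x∈p∩q⁻; p─q⊆p; x∈p∧x≢y⇒x∈p-y;
         x∈∁p⇒x∉p; x∉p⇒x∈∁p; x∈p⇒x∉∁p; x∉∁p⇒x∈p; ∣∁p∣≡n∸∣p∣)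
open import Data.Fin.Subset.Induction using (⊂-wellFounded; Acc; acc)
open import Data.Vec.Base using (_∷_; []; here; there; lookup)
open import Data.Vec.Properties using ([]=⇒lookup; lookup⇒[]=; ≡-dec)
open import Data.Product using (Σ; _×_; _,_; proj₁; proj₂; map)
open import Data.Sum using (_⊎_; inj₁; inj₂)
open import Data.Empty using (⊥-elim)
open import Function using (_∘_; id; _⇔_; mk⇔; Equivalence)
open import Relation.Nullary using (¬_; Dec; yes; no)
import Relation.Nullary.Decidable as Dec
open import Relation.Nullary.Decidable using (decidable-stable; ¬?; _×-dec_; _→-dec_)
open import Function.Construct.Symmetry using (⇔-sym)
import Data.Bool as Bool
open import Data.Integer using (ℤ)
import Data.Rational as ℚ
open import Data.Rational using (ℚ)
import Data.Rational.Properties as ℚP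
open import Relation.Binary.PropositionalEquality as ≡ using (_≡_; _≢_)

by-cases : ∀ {p n} (P : Fin n → Set p) i j → (i ≡ j → P i) → (i ≢ j → P i) → P i
by-cases P i j same other with i FinP.≟ j
... | yes i≡j = same i≡j
... | no  i≢j = other i≢j

x∉p-x : ∀ {n} (p : Subset n) (x : Fin n) → x ∉ p ∖ x
x∉p-x (inside ∷ p)  zero    ()
x∉p-x (outside ∷ p) zero    ()
x∉p-x (_ ∷ p)       (suc x) (there x∈p-x) = x∉p-x p x x∈p-x

∣p∣≤1+∣p-x∣ : ∀ {n} (p : Subset n) (x : Fin n) → x ∈ p → ∣ p ∣ ≤ suc ∣ p ∖ x ∣
∣p∣≤1+∣p-x∣ (inside ∷ p)  zero    here        = s≤s (ℕP.≤-reflexive (≡.cong ∣_∣ (≡.sym (p─⊥≡p p))))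
∣p∣≤1+∣p-x∣ (inside ∷ p)  (suc x) (there x∈p) = s≤s (∣p∣≤1+∣p-x∣ p x x∈p)
∣p∣≤1+∣p-x∣ (outside ∷ p) (suc x) (there x∈p) = ∣p∣≤1+∣p-x∣ p x x∈p

∣Empty∣≡0 : ∀ {n} {p : Subset n} → Empty p → ∣ p ∣ ≡ 0
∣Empty∣≡0 {n} empty = ≡.trans (≡.cong ∣_∣ (Empty-unique empty)) (∣⊥∣≡0 n)

⊆-∪⁅⁆-avoiding : ∀ {n} {C A : Subset n} {e} → C ⊆ A ∪ ⁅ e ⁆ → e ∉ C → C ⊆ A
⊆-∪⁅⁆-avoiding {A = A} {e} C⊆ e∉C {x} x∈C with x∈p∪q⁻ A ⁅ e ⁆ (C⊆ x∈C)
... | inj₁ x∈A = x∈A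
... | inj₂ x∈e = ⊥-elim (e∉C (≡.subst (_∈ _) (x∈⁅y⁆⇒x≡y e x∈e) x∈C))

-- C meets Z exactly in e: the shape of a fundamental (co)circuit relative to
-- its (co)basis, which makes its signed row "diagonal" on Z.
MeetsExactlyAt : ∀ {n} → Subset n → Subset n → Fin n → Set
MeetsExactlyAt C Z e = e ∈ C × (∀ j → j ∈ Z → j ≢ e → j ∉ C)

meets-exactly : ∀ {n} {C A Z : Subset n} {e} → e ∈ C → C ⊆ A ∪ ⁅ e ⁆ →
  (∀ j → j ∈ Z → j ∉ A) → MeetsExactlyAt C Z e
meets-exactly {C = C} {A} {Z} {e} e∈C C⊆ Z∩A=∅ = e∈C , avoids
  where
  avoids : ∀ j → j ∈ Z → j ≢ e → j ∉ C
  avoids j j∈Z j≢e j∈C with x∈p∪q⁻ A ⁅ e ⁆ (C⊆ j∈C)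
  ... | inj₁ j∈A = Z∩A=∅ j j∈Z j∈A
  ... | inj₂ j∈e = j≢e (x∈⁅y⁆⇒x≡y e j∈e)

minimal-subset : ∀ {n} (Q : Subset n → Set) → (∀ X → Dec (Q X)) → ∀ S → Q S →
  Σ (Subset n) λ C → C ⊆ S × Q C × (∀ X → X ⊆ C → Q X → C ⊆ X)
minimal-subset {n} Q Q? S qS = search S (⊂-wellFounded S) qS
  where
  search : ∀ S → Acc _⊂_ S → Q S →
    Σ (Subset n) λ C → C ⊆ S × Q C × (∀ X → X ⊆ C → Q X → C ⊆ X)
  search S (acc smaller) qS with anySubset? (λ X → (X ⊂? S) ×-dec Q? X)
  ... | yes (X , X⊂S , qX) =
    let (C , C⊆X , minimal) = search X (smaller X⊂S) qX in C , proj₁ X⊂S ∘ C⊆X , minimal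
  ... | no none = S , id , qS , λ X X⊆S qX {x} x∈S →
    decidable-stable (x ∈? X) (λ x∉X → none (X , (X⊆S , x , x∈S , x∉X) , qX))

record Enumeration {n} (S : Subset n) (t : ℕ) : Set where
  field
    pos           : Fin t → Fin n
    pos-injective : ∀ k k' → pos k ≡ pos k' → k ≡ k'
    pos-∈         : ∀ k → pos k ∈ S
    pos-onto      : ∀ x → x ∈ S → Σ (Fin t) λ k → pos k ≡ x

enumerate : ∀ {n} (S : Subset n) → Enumeration S ∣ S ∣
enumerate []            = record { pos = λ () ; pos-injective = λ () ; pos-∈ = λ () ; pos-onto = λ () }
enumerate (outside ∷ S) = record
  { pos           = suc ∘ pos
  ; pos-injective = λ k k' eq → pos-injective k k' (FinP.suc-injective eq)
  ; pos-∈         = there ∘ pos-∈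
  ; pos-onto      = onto
  }
  where
  open Enumeration (enumerate S)
  onto : ∀ x → x ∈ outside ∷ S → Σ _ λ k → suc (pos k) ≡ x
  onto (suc x) (there x∈S) = let (k , eq) = pos-onto x x∈S in k , ≡.cong suc eq
enumerate (inside ∷ S) = record
  { pos = pos′ ; pos-injective = injective ; pos-∈ = ∈S ; pos-onto = onto }
  where
  open Enumeration (enumerate S)
  pos′ : Fin (suc ∣ S ∣) → Fin _
  pos′ zero    = zero
  pos′ (suc k) = suc (pos k)
  injective : ∀ k k' → pos′ k ≡ pos′ k' → k ≡ k'
  injective zero    zero     _  = ≡.refl
  injective (suc k) (suc k') eq = ≡.cong suc (pos-injective k k' (FinP.suc-injective eq))
  ∈S : ∀ k → pos′ k ∈ inside ∷ S
  ∈S zero    = here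
  ∈S (suc k) = there (pos-∈ k)
  onto : ∀ x → x ∈ inside ∷ S → Σ _ λ k → pos′ k ≡ x
  onto zero    here        = zero , ≡.refl
  onto (suc x) (there x∈S) = let (k , eq) = pos-onto x x∈S in suc k , ≡.cong suc eq

enumeration : ∀ {n} (S : Subset n) t → ∣ S ∣ ≡ t → Enumeration S t
enumeration S t ∣S∣≡t = ≡.subst (Enumeration S) ∣S∣≡t (enumerate S)

module LinearAlgebra {c ℓ} (K : Field c ℓ) where
  open Field K hiding (zero)
  open LinAlg K
  open import Relation.Binary.Reasoning.Setoid setoid
  open import Algebra.Properties.Ring ring using (-‿distribˡ-*; -‿distribʳ-*; -0#≈0#; x∙y⁻¹≈ε⇒x≈y)
  open import Algebra.Properties.AbelianGroup +-abelianGroup using (⁻¹-∙-comm)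
  open import Algebra.Properties.CommutativeSemigroup +-commutativeSemigroup using (interchange)

  sum-cong : ∀ {m} {f g : Fin m → Carrier} → (∀ i → f i ≈ g i) → sumFin f ≈ sumFin g
  sum-cong {zero}  f≈g = refl
  sum-cong {suc m} f≈g = +-cong (f≈g zero) (sum-cong (f≈g ∘ suc))

  sum-zero : ∀ {m} {f : Fin m → Carrier} → (∀ i → f i ≈ 0#) → sumFin f ≈ 0#
  sum-zero {zero}  f≈0 = refl
  sum-zero {suc m} f≈0 = trans (+-cong (f≈0 zero) (sum-zero (f≈0 ∘ suc))) (+-identityˡ 0#)

  sum-+ : ∀ {m} (f g : Fin m → Carrier) → sumFin (λ i → f i + g i) ≈ sumFin f + sumFin g
  sum-+ {zero}  f g = sym (+-identityˡ 0#)
  sum-+ {suc m} f g = trans (+-congˡ (sum-+ (f ∘ suc) (g ∘ suc)))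
    (interchange (f zero) (g zero) (sumFin (f ∘ suc)) (sumFin (g ∘ suc)))

  sum-*ˡ : ∀ {m} x (f : Fin m → Carrier) → x * sumFin f ≈ sumFin (λ i → x * f i)
  sum-*ˡ {zero}  x f = zeroʳ x
  sum-*ˡ {suc m} x f = trans (distribˡ x _ _) (+-congˡ (sum-*ˡ x (f ∘ suc)))

  sum-*ʳ : ∀ {m} x (f : Fin m → Carrier) → sumFin f * x ≈ sumFin (λ i → f i * x)
  sum-*ʳ x f = trans (*-comm _ x) (trans (sum-*ˡ x f) (sum-cong (λ i → *-comm x (f i))))

  sum-neg : ∀ {m} (f : Fin m → Carrier) → sumFin (λ i → - f i) ≈ - sumFin f
  sum-neg {zero}  f = sym -0#≈0#
  sum-neg {suc m} f = trans (+-congˡ (sum-neg (f ∘ suc))) (⁻¹-∙-comm (f zero) (sumFin (f ∘ suc)))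

  sum-swap : ∀ {m p} (f : Fin m → Fin p → Carrier) →
    sumFin (λ i → sumFin (f i)) ≈ sumFin (λ k → sumFin (λ i → f i k))
  sum-swap {zero}  {p} f = sym (sum-zero {p} (λ k → refl))
  sum-swap {suc m} f = trans (+-congˡ (sum-swap (f ∘ suc)))
    (sym (sum-+ (f zero) (λ k → sumFin (λ i → f (suc i) k))))

  sum-single : ∀ {m} (f : Fin m → Carrier) k → (∀ i → i ≢ k → f i ≈ 0#) → sumFin f ≈ f k
  sum-single {suc m} f zero    f≈0 =
    trans (+-congˡ (sum-zero (λ i → f≈0 (suc i) λ ()))) (+-identityʳ _)
  sum-single {suc m} f (suc k) f≈0 =
    trans (+-cong (f≈0 zero λ ())
                  (sum-single (f ∘ suc) k (λ i i≢k → f≈0 (suc i) (i≢k ∘ FinP.suc-injective))))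
          (+-identityˡ _)

  dot : ∀ {n} → (Fin n → Carrier) → (Fin n → Carrier) → Carrier
  dot x y = sumFin (λ j → x j * y j)

  dot-comm : ∀ {n} (x y : Fin n → Carrier) → dot x y ≈ dot y x
  dot-comm x y = sum-cong (λ j → *-comm (x j) (y j))

  combo : ∀ {k m} → (Fin k → Carrier) → (Fin k → Fin m → Carrier) → Fin m → Carrier
  combo a w r = sumFin (λ i → a i * w i r)

  sum-disjoint : ∀ {k} (X : Subset k) (a b : Fin k → Carrier) →
    (∀ j → j ∉ X → a j ≈ 0#) → (∀ j → j ∈ X → b j ≈ 0#) → dot a b ≈ 0#
  sum-disjoint X a b a≈0 b≈0 = sum-zero term
    where
    term : ∀ j → a j * b j ≈ 0#
    term j with j ∈? X
    ... | yes j∈X = trans (*-congˡ (b≈0 j j∈X)) (zeroʳ _)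
    ... | no  j∉X = trans (*-congʳ (a≈0 j j∉X)) (zeroˡ _)

  cancel-invertible : ∀ {x p q} → p * q ≈ 1# → x * p ≈ 0# → x ≈ 0#
  cancel-invertible {x} {p} {q} pq≈1 xp≈0 = begin
    x            ≈⟨ sym (*-identityʳ x) ⟩
    x * 1#       ≈⟨ *-congˡ (sym pq≈1) ⟩
    x * (p * q)  ≈⟨ sym (*-assoc x p q) ⟩
    (x * p) * q  ≈⟨ *-congʳ xp≈0 ⟩
    0# * q       ≈⟨ zeroˡ q ⟩
    0#           ∎

  unit : ∀ {m} → Fin m → Carrier → Fin m → Carrier
  unit j α i with i FinP.≟ j
  ... | yes _ = α
  ... | no  _ = 0#

  unit-same : ∀ {m} (j : Fin m) α → unit j α j ≈ α
  unit-same j α with j FinP.≟ j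
  ... | yes _   = refl
  ... | no  j≢j = ⊥-elim (j≢j ≡.refl)

  unit-other : ∀ {m} (j : Fin m) α i → i ≢ j → unit j α i ≈ 0#
  unit-other j α i i≢j with i FinP.≟ j
  ... | yes i≡j = ⊥-elim (i≢j i≡j)
  ... | no  _   = refl

  unit-supported : ∀ {m} {X : Subset m} {j} α → j ∈ X → ∀ i → i ∉ X → unit j α i ≈ 0#
  unit-supported {X = X} {j} α j∈X i i∉X =
    unit-other j α i (λ i≡j → i∉X (≡.subst (_∈ X) (≡.sym i≡j) j∈X))

  sum-shift : ∀ {m} (a g : Fin m → Carrier) j α →
    dot (λ i → a i + unit j α i) g ≈ dot a g + α * g j
  sum-shift a g j α = begin
    dot (λ i → a i + unit j α i) g            ≈⟨ sum-cong (λ i → distribʳ (g i) (a i) (unit j α i)) ⟩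
    sumFin (λ i → a i * g i + unit j α i * g i) ≈⟨ sum-+ (λ i → a i * g i) (λ i → unit j α i * g i) ⟩
    dot a g + dot (unit j α) g               ≈⟨ +-congˡ (sum-single _ j unit-term) ⟩
    dot a g + unit j α j * g j               ≈⟨ +-congˡ (*-congʳ (unit-same j α)) ⟩
    dot a g + α * g j                        ∎
    where
    unit-term : ∀ i → i ≢ j → unit j α i * g i ≈ 0#
    unit-term i i≢j = trans (*-congʳ (unit-other j α i i≢j)) (zeroˡ _)

  shift-other : ∀ {m} (a : Fin m → Carrier) j α i → i ≢ j → a i + unit j α i ≈ a i
  shift-other a j α i i≢j = trans (+-congˡ (unit-other j α i i≢j)) (+-identityʳ _)

  IndepOn : ∀ {k m} → (Fin k → Fin m → Carrier) → Subset k → Set (c ⊔ ℓ)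
  IndepOn {k} w X = ∀ (a : Fin k → Carrier) → (∀ i → i ∉ X → a i ≈ 0#) →
    (∀ r → combo a w r ≈ 0#) → ∀ i → a i ≈ 0#

  no-columns-⇔ : ∀ {k} (w : Fin k → Fin 0 → Carrier) X → IndepOn w X ⇔ Empty X
  no-columns-⇔ w X = mk⇔ to from
    where
    to : IndepOn w X → Empty X
    to ind (j , j∈X) = 0≉1 (sym (trans (sym (unit-same j 1#))
      (ind (unit j 1#) (unit-supported 1# j∈X) (λ ()) j)))
    from : Empty X → IndepOn w X
    from empty a a∉X≈0 _ i = a∉X≈0 i (λ i∈X → empty (i , i∈X))

  dropFirstColumn : ∀ {k m} → (Fin k → Fin (suc m) → Carrier) → Fin k → Fin m → Carrier
  dropFirstColumn w i r = w i (suc r)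

  zero-column-⇔ : ∀ {k m} (w : Fin k → Fin (suc m) → Carrier) X →
    (∀ i → i ∈ X → w i zero ≈ 0#) → IndepOn w X ⇔ IndepOn (dropFirstColumn w) X
  zero-column-⇔ w X column≈0 = mk⇔
    (λ ind a a∉X≈0 combo≈0 → ind a a∉X≈0 (all-columns a a∉X≈0 combo≈0))
    (λ ind a a∉X≈0 combo≈0 → ind a a∉X≈0 (combo≈0 ∘ suc))
    where
    all-columns : ∀ a → (∀ i → i ∉ X → a i ≈ 0#) →
      (∀ r → combo a (dropFirstColumn w) r ≈ 0#) → ∀ r → combo a w r ≈ 0#
    all-columns a a∉X≈0 _       zero    = sum-disjoint X a (λ i → w i zero) a∉X≈0 column≈0
    all-columns a _      combo≈0 (suc r) = combo≈0 r

  -- Gaussian elimination, step 2: if the pivot p = wⱼ₀ (j ∈ X) has inverse q,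
  -- subtract (wᵢ₀ q) · wⱼ from every row i and drop the first column; row j
  -- becomes zero and is removed from X.
  eliminate : ∀ {k m} → (Fin k → Fin (suc m) → Carrier) → Fin k → Carrier → Fin k → Fin m → Carrier
  eliminate w j q i r = w i (suc r) + - ((w i zero * q) * w j (suc r))

  combo-eliminate : ∀ {k m} (w : Fin k → Fin (suc m) → Carrier) j q (b : Fin k → Carrier) r →
    combo b (eliminate w j q) r ≈ combo b w (suc r) + combo b w zero * - (q * w j (suc r))
  combo-eliminate w j q b r = begin
    combo b (eliminate w j q) r
      ≈⟨ sum-cong term ⟩
    sumFin (λ i → b i * w i (suc r) + (b i * w i zero) * κ)
      ≈⟨ sum-+ (λ i → b i * w i (suc r)) (λ i → (b i * w i zero) * κ) ⟩
    combo b w (suc r) + sumFin (λ i → (b i * w i zero) * κ)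
      ≈⟨ +-congˡ (sym (sum-*ʳ κ (λ i → b i * w i zero))) ⟩
    combo b w (suc r) + combo b w zero * κ
      ∎
    where
    κ : Carrier
    κ = - (q * w j (suc r))
    term : ∀ i → b i * eliminate w j q i r ≈ b i * w i (suc r) + (b i * w i zero) * κ
    term i = trans (distribˡ (b i) _ _) (+-congˡ (begin
      b i * - ((w i zero * q) * w j (suc r))  ≈⟨ sym (-‿distribʳ-* (b i) _) ⟩
      - (b i * ((w i zero * q) * w j (suc r))) ≈⟨ -‿cong (*-congˡ (*-assoc (w i zero) q _)) ⟩
      - (b i * (w i zero * (q * w j (suc r)))) ≈⟨ -‿cong (sym (*-assoc (b i) (w i zero) _)) ⟩
      - ((b i * w i zero) * (q * w j (suc r))) ≈⟨ -‿distribʳ-* (b i * w i zero) _ ⟩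
      (b i * w i zero) * κ                     ∎))

  eliminate-pivot-row : ∀ {k m} (w : Fin k → Fin (suc m) → Carrier) j q →
    w j zero * q ≈ 1# → ∀ r → eliminate w j q j r ≈ 0#
  eliminate-pivot-row w j q pq≈1 r =
    trans (+-congˡ (-‿cong (trans (*-congʳ pq≈1) (*-identityˡ _)))) (-‿inverseʳ _)

  pivot-⇔ : ∀ {k m} (w : Fin k → Fin (suc m) → Carrier) X j q → j ∈ X → w j zero * q ≈ 1# →
    IndepOn w X ⇔ IndepOn (eliminate w j q) (X ∖ j)
  pivot-⇔ w X j q j∈X pq≈1 = mk⇔ forward backward
    where
    p : Carrier
    p = w j zero

    -- a dependency a′ of the reduced rows, corrected at row j, is one of w
    forward : IndepOn w X → IndepOn (eliminate w j q) (X ∖ j)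
    forward ind a′ a′≈0 combo′≈0 = result
      where
      S α : Carrier
      S = combo a′ w zero
      α = - (S * q)
      a : Fin _ → Carrier
      a i = a′ i + unit j α i
      combo≈0 : ∀ r → combo a w r ≈ 0#
      combo≈0 zero = begin
        combo a w zero       ≈⟨ sum-shift a′ (λ i → w i zero) j α ⟩
        S + - (S * q) * p    ≈⟨ +-congˡ (sym (-‿distribˡ-* (S * q) p)) ⟩
        S + - ((S * q) * p)  ≈⟨ +-congˡ (-‿cong (trans (*-assoc S q p) (*-congˡ (*-comm q p)))) ⟩
        S + - (S * (p * q))  ≈⟨ +-congˡ (-‿cong (trans (*-congˡ pq≈1) (*-identityʳ S))) ⟩
        S + - S              ≈⟨ -‿inverseʳ S ⟩
        0#                   ∎
      combo≈0 (suc r) = begin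
        combo a w (suc r)                                     ≈⟨ sum-shift a′ (λ i → w i (suc r)) j α ⟩
        combo a′ w (suc r) + - (S * q) * w j (suc r)           ≈⟨ +-congˡ (begin
          - (S * q) * w j (suc r)    ≈⟨ sym (-‿distribˡ-* _ _) ⟩
          - ((S * q) * w j (suc r))  ≈⟨ -‿cong (*-assoc S q _) ⟩
          - (S * (q * w j (suc r)))  ≈⟨ -‿distribʳ-* S _ ⟩
          S * - (q * w j (suc r))    ∎) ⟩
        combo a′ w (suc r) + S * - (q * w j (suc r))           ≈⟨ sym (combo-eliminate w j q a′ r) ⟩
        combo a′ (eliminate w j q) r                          ≈⟨ combo′≈0 r ⟩
        0#                                                    ∎
      a≈0 : ∀ i → i ∉ X → a i ≈ 0#
      a≈0 i i∉X = trans (shift-other a′ j α i i≢j) (a′≈0 i (i∉X ∘ p─q⊆p X ⁅ j ⁆))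
        where
        i≢j : i ≢ j
        i≢j i≡j = i∉X (≡.subst (_∈ X) (≡.sym i≡j) j∈X)
      result : ∀ i → a′ i ≈ 0#
      result i = by-cases (λ x → a′ x ≈ 0#) i j (λ { ≡.refl → a′≈0 j (x∉p-x X j) })
        (λ i≢j → trans (sym (shift-other a′ j α i i≢j)) (ind a a≈0 combo≈0 i))

    -- for a dependency a of w, clearing row j gives one of the reduced rows
    backward : IndepOn (eliminate w j q) (X ∖ j) → IndepOn w X
    backward ind a a∉X≈0 combo≈0 = result
      where
      a′ : Fin _ → Carrier
      a′ i = a i + unit j (- a j) i
      a′j≈0 : a′ j ≈ 0#
      a′j≈0 = trans (+-congˡ (unit-same j (- a j))) (-‿inverseʳ (a j))
      a′≈0 : ∀ i → i ∉ X ∖ j → a′ i ≈ 0#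
      a′≈0 i i∉X-j = by-cases (λ x → a′ x ≈ 0#) i j (λ { ≡.refl → a′j≈0 })
        (λ i≢j → trans (shift-other a j _ i i≢j) (a∉X≈0 i (λ i∈X → i∉X-j (x∈p∧x≢y⇒x∈p-y i∈X i≢j))))
      combo′≈0 : ∀ r → combo a′ (eliminate w j q) r ≈ 0#
      combo′≈0 r = begin
        combo a′ (eliminate w j q) r
          ≈⟨ sum-shift a (λ i → eliminate w j q i r) j (- a j) ⟩
        combo a (eliminate w j q) r + - a j * eliminate w j q j r
          ≈⟨ +-congˡ (trans (*-congˡ (eliminate-pivot-row w j q pq≈1 r)) (zeroʳ _)) ⟩
        combo a (eliminate w j q) r + 0#
          ≈⟨ +-identityʳ _ ⟩
        combo a (eliminate w j q) r
          ≈⟨ combo-eliminate w j q a r ⟩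
        combo a w (suc r) + combo a w zero * - (q * w j (suc r))
          ≈⟨ +-cong (combo≈0 (suc r)) (trans (*-congʳ (combo≈0 zero)) (zeroˡ _)) ⟩
        0# + 0#
          ≈⟨ +-identityˡ 0# ⟩
        0#
          ∎
      others≈0 : ∀ i → i ≢ j → a i ≈ 0#
      others≈0 i i≢j = trans (sym (shift-other a j _ i i≢j)) (ind a′ a′≈0 combo′≈0 i)
      aj≈0 : a j ≈ 0#
      aj≈0 = cancel-invertible pq≈1 (trans (sym (sum-single (λ i → a i * w i zero) j
        (λ i i≢j → trans (*-congʳ (others≈0 i i≢j)) (zeroˡ _)))) (combo≈0 zero))
      result : ∀ i → a i ≈ 0#
      result i = by-cases (λ x → a x ≈ 0#) i j (λ { ≡.refl → aj≈0 }) (others≈0 i)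

  ¬¬-all-or-counterexample : ∀ {p k} (P : Fin k → Set p) →
    ¬ ¬ ((∀ i → P i) ⊎ Σ (Fin k) λ i → ¬ P i)
  ¬¬-all-or-counterexample {k = zero}  P refute = refute (inj₁ λ ())
  ¬¬-all-or-counterexample {k = suc k} P refute = ¬¬-all-or-counterexample (P ∘ suc) λ
    { (inj₂ (i , ¬Pi)) → refute (inj₂ (suc i , ¬Pi))
    ; (inj₁ all)       → refute (inj₂ (zero , λ P0 → refute (inj₁ λ { zero → P0 ; (suc i) → all i })))
    }

  -- At most m rows of length m are independent.  By elimination on the first
  -- column; the case split is classical, which is harmless since the
  -- conclusion is decidable.
  independent-≤ : ∀ m {k} (w : Fin k → Fin m → Carrier) X → IndepOn w X → ∣ X ∣ ≤ m
  independent-≤ zero    w X ind = ℕP.≤-reflexive (∣Empty∣≡0 (Equivalence.to (no-columns-⇔ w X) ind))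
  independent-≤ (suc m) w X ind = decidable-stable (∣ X ∣ ℕ.≤? suc m) λ too-big →
    ¬¬-all-or-counterexample (λ i → i ∈ X → w i zero ≈ 0#) λ
      { (inj₁ column≈0)  → too-big (ℕP.m≤n⇒m≤1+n (drop-zero-column column≈0))
      ; (inj₂ (j , ¬≈0)) → too-big (eliminate-pivot j (pivot-in-X ¬≈0) (λ wj≈0 → ¬≈0 (λ _ → wj≈0)))
      }
    where
    drop-zero-column : (∀ i → i ∈ X → w i zero ≈ 0#) → ∣ X ∣ ≤ m
    drop-zero-column column≈0 =
      independent-≤ m _ X (Equivalence.to (zero-column-⇔ w X column≈0) ind)
    pivot-in-X : ∀ {j} → ¬ (j ∈ X → w j zero ≈ 0#) → j ∈ X
    pivot-in-X {j} ¬≈0 = decidable-stable (j ∈? X) (λ j∉X → ¬≈0 (λ j∈X → ⊥-elim (j∉X j∈X)))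
    eliminate-pivot : ∀ j → j ∈ X → ¬ (w j zero ≈ 0#) → ∣ X ∣ ≤ suc m
    eliminate-pivot j j∈X wj≉0 with inverse (w j zero) wj≉0
    ... | q , pq≈1 = ℕP.≤-trans (∣p∣≤1+∣p-x∣ X j j∈X)
      (s≤s (independent-≤ m _ (X ∖ j) (Equivalence.to (pivot-⇔ w X j q j∈X pq≈1) ind)))

  indepOn? : (∀ x → Dec (x ≈ 0#)) → ∀ m {k} (w : Fin k → Fin m → Carrier) X → Dec (IndepOn w X)
  indepOn? ≈0? zero    w X = Dec.map (⇔-sym (no-columns-⇔ w X)) (¬? (nonempty? X))
  indepOn? ≈0? (suc m) w X with FinP.any? (λ j → (j ∈? X) ×-dec ¬? (≈0? (w j zero)))
  ... | yes (j , j∈X , wj≉0) =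
    let (q , pq≈1) = inverse (w j zero) wj≉0
    in Dec.map (⇔-sym (pivot-⇔ w X j q j∈X pq≈1)) (indepOn? ≈0? m _ (X ∖ j))
  ... | no no-pivot = Dec.map (⇔-sym (zero-column-⇔ w X column≈0)) (indepOn? ≈0? m _ X)
    where
    column≈0 : ∀ i → i ∈ X → w i zero ≈ 0#
    column≈0 i i∈X = decidable-stable (≈0? (w i zero)) (λ wi≉0 → no-pivot (i , i∈X , wi≉0))

  -- Steinitz: p independent vectors in the span of t vectors force p ≤ t, since
  -- their coefficient rows (of length t) are then independent too.
  spanned-≤ : ∀ {n t p} (v : Fin p → Fin n → Carrier) (F : Fin t → Fin n → Carrier)
    (coeff : Fin p → Fin t → Carrier) → (∀ i j → v i j ≈ combo (coeff i) F j) →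
    LinIndep v → p ≤ t
  spanned-≤ {n} {t} {p} v F coeff v≈ v-indep =
    ≡.subst (_≤ t) (∣⊤∣≡n p) (independent-≤ t coeff ⊤ (λ a _ → v-indep a ∘ combo-v≈0 a))
    where
    combo-v≈0 : ∀ a → (∀ k → combo a coeff k ≈ 0#) → ∀ j → combo a v j ≈ 0#
    combo-v≈0 a coeff≈0 j = begin
      sumFin (λ i → a i * v i j)
        ≈⟨ sum-cong (λ i → *-congˡ (v≈ i j)) ⟩
      sumFin (λ i → a i * sumFin (λ k → coeff i k * F k j))
        ≈⟨ sum-cong (λ i → trans (sum-*ˡ (a i) (λ k → coeff i k * F k j))
                                 (sum-cong (λ k → sym (*-assoc (a i) (coeff i k) (F k j))))) ⟩
      sumFin (λ i → sumFin (λ k → (a i * coeff i k) * F k j))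
        ≈⟨ sum-swap (λ i k → (a i * coeff i k) * F k j) ⟩
      sumFin (λ k → sumFin (λ i → (a i * coeff i k) * F k j))
        ≈⟨ sum-cong (λ k → sym (sum-*ʳ (F k j) (λ i → a i * coeff i k))) ⟩
      sumFin (λ k → combo a coeff k * F k j)
        ≈⟨ sum-zero (λ k → trans (*-congʳ (coeff≈0 k)) (zeroˡ _)) ⟩
      0#
        ∎

  -- x has a unit entry at e (x e · x e = 1, e.g. x e = ±1) and vanishes on
  -- the rest of Z.
  Isolated : ∀ {n} → (Fin n → Carrier) → Subset n → Fin n → Set ℓ
  Isolated x Z e = x e * x e ≈ 1# × (∀ j → j ∈ Z → j ≢ e → x j ≈ 0#)

  diagonal-independent : ∀ {n t} (u : Fin t → Fin n) (F : Fin t → Fin n → Carrier) →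
    (∀ k k' → k' ≢ k → F k' (u k) ≈ 0#) → (∀ k → F k (u k) * F k (u k) ≈ 1#) → LinIndep F
  diagonal-independent u F off-diagonal diagonal a combo≈0 k = cancel-invertible (diagonal k)
    (trans (sym (sum-single (λ i → a i * F i (u k)) k
                  (λ i i≢k → trans (*-congˡ (off-diagonal k i i≢k)) (zeroʳ _))))
           (combo≈0 (u k)))

  combo-orthogonal : ∀ {n t} (λs : Fin t → Carrier) (F : Fin t → Fin n → Carrier) G →
    (∀ k → dot (F k) G ≈ 0#) → dot (combo λs F) G ≈ 0#
  combo-orthogonal λs F G F⊥G = begin
    sumFin (λ j → combo λs F j * G j)
      ≈⟨ sum-cong (λ j → sum-*ʳ (G j) (λ k → λs k * F k j)) ⟩
    sumFin (λ j → sumFin (λ k → (λs k * F k j) * G j))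
      ≈⟨ sum-swap (λ j k → (λs k * F k j) * G j) ⟩
    sumFin (λ k → sumFin (λ j → (λs k * F k j) * G j))
      ≈⟨ sum-cong (λ k → trans (sum-cong (λ j → *-assoc (λs k) (F k j) (G j)))
                               (sym (sum-*ˡ (λs k) (λ j → F k j * G j)))) ⟩
    sumFin (λ k → λs k * dot (F k) G)
      ≈⟨ sum-zero (λ k → trans (*-congˡ (F⊥G k)) (zeroʳ _)) ⟩
    0#
      ∎

  dot-isolated : ∀ {n} (S : Subset n) s (y G : Fin n → Carrier) → Isolated G S s →
    (∀ j → j ∉ S → y j ≈ 0#) → dot y G ≈ y s * G s
  dot-isolated S s y G (_ , G≈0) y≈0 = sum-single (λ j → y j * G j) s term
    where
    term : ∀ j → j ≢ s → y j * G j ≈ 0#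
    term j j≢s with j ∈? S
    ... | yes j∈S = trans (*-congˡ (G≈0 j j∈S j≢s)) (zeroʳ _)
    ... | no  j∉S = trans (*-congʳ (y≈0 j j∉S)) (zeroˡ _)

  pivot-expansion : ∀ {n t} (S : Subset n) (u : Fin t → Fin n) (F : Fin t → Fin n → Carrier)
    (x : Fin n → Carrier) →
    (∀ j → j ∉ S → Σ (Fin t) λ k → u k ≡ j) →
    (∀ k k' → k' ≢ k → F k' (u k) ≈ 0#) → (∀ k → F k (u k) * F k (u k) ≈ 1#) →
    (∀ s → s ∈ S → Σ (Fin n → Carrier) λ G →
       Isolated G S s × dot x G ≈ 0# × (∀ k → dot (F k) G ≈ 0#)) →
    ∀ j → x j ≈ combo (λ k → x (u k) * F k (u k)) F j
  pivot-expansion {n} {t} S u F x covered off-diagonal diagonal test j =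
    x∙y⁻¹≈ε⇒x≈y _ _ (residual≈0 j)
    where
    λs : Fin t → Carrier
    λs k = x (u k) * F k (u k)
    residual : Fin n → Carrier
    residual j = x j + - combo λs F j
    residual-off-S : ∀ j → j ∉ S → residual j ≈ 0#
    residual-off-S j j∉S with covered j j∉S
    ... | k , ≡.refl = begin
      x (u k) + - combo λs F (u k)   ≈⟨ +-congˡ (-‿cong (sum-single (λ k' → λs k' * F k' (u k)) k
                                          (λ k' k'≢k → trans (*-congˡ (off-diagonal k k' k'≢k)) (zeroʳ _)))) ⟩
      x (u k) + - (λs k * F k (u k)) ≈⟨ +-congˡ (-‿cong (trans (*-assoc _ _ _)
                                          (trans (*-congˡ (diagonal k)) (*-identityʳ _)))) ⟩
      x (u k) + - x (u k)            ≈⟨ -‿inverseʳ _ ⟩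
      0#                             ∎
    residual-on-S : ∀ s → s ∈ S → residual s ≈ 0#
    residual-on-S s s∈S with test s s∈S
    ... | G , G-isolated , x⊥G , F⊥G = cancel-invertible (proj₁ G-isolated) (begin
      residual s * G s
        ≈⟨ sym (dot-isolated S s residual G G-isolated residual-off-S) ⟩
      dot residual G
        ≈⟨ sum-cong (λ j → trans (distribʳ (G j) (x j) _) (+-congˡ (sym (-‿distribˡ-* _ _)))) ⟩
      sumFin (λ j → x j * G j + - (combo λs F j * G j))
        ≈⟨ trans (sum-+ (λ j → x j * G j) _) (+-congˡ (sum-neg (λ j → combo λs F j * G j))) ⟩
      dot x G + - dot (combo λs F) G
        ≈⟨ +-cong x⊥G (-‿cong (combo-orthogonal λs F G F⊥G)) ⟩
      0# + - 0#
        ≈⟨ -‿inverseʳ 0# ⟩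
      0#
        ∎)
    residual≈0 : ∀ j → residual j ≈ 0#
    residual≈0 j with j ∈? S
    ... | yes j∈S = residual-on-S j j∈S
    ... | no  j∉S = residual-off-S j j∉S

  orthogonal-rank : ∀ {a b} {I : Set a} {J : Set b} {n t}
    (v : I → Fin n → Carrier) (w : J → Fin n → Carrier) (S T : Subset n) →
    (∀ j → j ∉ S → j ∈ T) → ∣ T ∣ ≡ t →
    (∀ i j → dot (v i) (w j) ≈ 0#) →
    (∀ e → e ∈ T → Σ I λ i → Isolated (v i) T e) →
    (∀ s → s ∈ S → Σ J λ j → Isolated (w j) S s) →
    HasRank v t
  orthogonal-rank {I = I} {n = n} {t} v w S T cover ∣T∣≡t v⊥w pivot test =
    (ι , diagonal-independent pos F off-diagonal diagonal) ,
    λ g g-indep → ℕP.<-irrefl ≡.refl (spanned-≤ (v ∘ g) F _ (expansion ∘ g) g-indep)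
    where
    open Enumeration (enumeration T t ∣T∣≡t)
    ι : Fin t → I
    ι k = proj₁ (pivot (pos k) (pos-∈ k))
    F : Fin t → Fin n → Carrier
    F = v ∘ ι
    diagonal : ∀ k → F k (pos k) * F k (pos k) ≈ 1#
    diagonal k = proj₁ (proj₂ (pivot (pos k) (pos-∈ k)))
    off-diagonal : ∀ k k' → k' ≢ k → F k' (pos k) ≈ 0#
    off-diagonal k k' k'≢k = proj₂ (proj₂ (pivot (pos k') (pos-∈ k'))) (pos k) (pos-∈ k)
      (λ eq → k'≢k (pos-injective k' k (≡.sym eq)))
    expansion : ∀ i j → v i j ≈ combo (λ k → v i (pos k) * F k (pos k)) F j
    expansion i = pivot-expansion S pos F (v i) (λ j j∉S → pos-onto j (cover j j∉S))
      off-diagonal diagonal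
      (λ s s∈S → let (j , isolated) = test s s∈S in w j , isolated , v⊥w i j , λ k → v⊥w (ι k) j)

ℚ-field : Field 0ℓ 0ℓ
ℚ-field = record { commRing = ℚP.+-*-commutativeRing ; 0≉1 = λ () ; inverse = inverse }
  where
  inverse : ∀ x → x ≢ ℚ.0ℚ → Σ ℚ λ y → x ℚ.* y ≡ ℚ.1ℚ
  inverse x x≢0 = ℚ.1/_ x {{ℚ.≢-nonZero x≢0}} , ℚP.*-inverseʳ x {{ℚ.≢-nonZero x≢0}}

sumFin≡sumℚ : ∀ {m} (f : Fin m → ℚ) → LinAlg.sumFin ℚ-field f ≡ sumℚ f
sumFin≡sumℚ {zero}  f = ≡.refl
sumFin≡sumℚ {suc m} f = ≡.cong (f zero ℚ.+_) (sumFin≡sumℚ (f ∘ suc))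

columnsIndepℚ? : ∀ {m n} (A : Fin m → Fin n → ℤ) X → Dec (ColumnsIndepℚ A X)
columnsIndepℚ? {m} A X = Dec.map′ to from (indepOn? (ℚP._≟ ℚ.0ℚ) m Aᵀ X)
  where
  open LinearAlgebra ℚ-field using (IndepOn; indepOn?)
  Aᵀ : Fin _ → Fin m → ℚ
  Aᵀ j r = A r j ℚ./ 1
  to : IndepOn Aᵀ X → ColumnsIndepℚ A X
  to ind a a∉X≡0 combo≡0 =
    ind a a∉X≡0 (λ r → ≡.trans (sumFin≡sumℚ (λ j → a j ℚ.* Aᵀ j r)) (combo≡0 r))
  from : ColumnsIndepℚ A X → IndepOn Aᵀ X
  from ind a a∉X≡0 combo≡0 =
    ind a a∉X≡0 (λ r → ≡.trans (≡.sym (sumFin≡sumℚ (λ j → a j ℚ.* Aᵀ j r))) (combo≡0 r))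

regular⇒indep? : ∀ {n} (M : Matroid n) → IsRegular M → ∀ X → Dec (Matroid.Indep M X)
regular⇒indep? M (_ , A , _ , represents) X =
  Dec.map′ (proj₂ (represents X)) (proj₁ (represents X)) (columnsIndepℚ? A X)

module Bases {n} (M : Matroid n) where
  open Matroid M

  basis-≤ : ∀ {B B′} → IsBasis M B → IsBasis M B′ → ∣ B ∣ ≤ ∣ B′ ∣
  basis-≤ {B} {B′} (B-indep , _) (B′-indep , B′-maximal) with ∣ B ∣ ℕ.≤? ∣ B′ ∣
  ... | yes ≤ = ≤
  ... | no  ≰ with indep-aug B′-indep B-indep (ℕP.≰⇒> ≰)
  ...   | e , _ , e∉B′ , B′+e-indep =
    ⊥-elim (e∉B′ (B′-maximal _ (p⊆p∪q ⁅ e ⁆) B′+e-indep (q⊆p∪q B′ ⁅ e ⁆ (x∈⁅x⁆ e))))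

  basis-card : ∀ {B r} → IsBasis M B → HasMatroidRank M r → ∣ B ∣ ≡ r
  basis-card B-basis (B′ , B′-basis , ∣B′∣≡r) =
    ≡.trans (ℕP.≤-antisym (basis-≤ B-basis B′-basis) (basis-≤ B′-basis B-basis)) ∣B′∣≡r

  basis+e-dependent : ∀ {B e} → IsBasis M B → e ∉ B → ¬ Indep (B ∪ ⁅ e ⁆)
  basis+e-dependent {B} {e} (_ , maximal) e∉B B+e-indep =
    e∉B (maximal _ (p⊆p∪q ⁅ e ⁆) B+e-indep (q⊆p∪q B ⁅ e ⁆ (x∈⁅x⁆ e)))

  -- a dual-independent set is disjoint from a basis B′; if it contains ∁ B,
  -- then B′ ⊆ B, so B′ = B, so it avoids B
  basis-complement+b-codependent : ∀ {B b} → IsBasis M B → b ∈ B → ¬ IndepDual M (∁ B ∪ ⁅ b ⁆)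
  basis-complement+b-codependent {B} {b} B-basis b∈B (B′ , (_ , B′-maximal) , disjoint) =
    ∉⊥ (≡.subst (b ∈_) disjoint (x∈p∩q⁺ (q⊆p∪q (∁ B) ⁅ b ⁆ (x∈⁅x⁆ b) , B⊆B′ b∈B)))
    where
    B′⊆B : B′ ⊆ B
    B′⊆B {x} x∈B′ = decidable-stable (x ∈? B) λ x∉B →
      ∉⊥ (≡.subst (x ∈_) disjoint (x∈p∩q⁺ (p⊆p∪q ⁅ b ⁆ (x∉p⇒x∈∁p x∉B) , x∈B′)))
    B⊆B′ : B ⊆ B′
    B⊆B′ = B′-maximal B B′⊆B (proj₁ B-basis)

-- Fundamental circuits and cocircuits exist once independence is decidable:
-- they are minimal (co)dependent subsets of B ∪ {e}, resp. ∁ B ∪ {b}.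
module Fundamental {n} (M : Matroid n) (indep? : ∀ X → Dec (Matroid.Indep M X)) where
  open Matroid M
  open Bases M

  -- maximality quantifies over the finitely many subsets, so it is decidable
  isBasis? : ∀ X → Dec (IsBasis M X)
  isBasis? X = indep? X ×-dec all-subsets? (λ Y → (X ⊆? Y) →-dec (indep? Y →-dec (Y ⊆? X)))
    where
    all-subsets? : {P : Subset n → Set} → (∀ Y → Dec (P Y)) → Dec (∀ Y → P Y)
    all-subsets? P? with anySubset? (¬? ∘ P?)
    ... | yes (Y , ¬PY) = no (λ all → ¬PY (all Y))
    ... | no  none      = yes (λ Y → decidable-stable (P? Y) (λ ¬PY → none (Y , ¬PY)))

  indepDual? : ∀ X → Dec (IndepDual M X)
  indepDual? X = anySubset? (λ B′ → isBasis? B′ ×-dec ≡-dec Bool._≟_ (X ∩ B′) ⊥)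

  module _ {B : Subset n} (B-basis : IsBasis M B) where

    -- a dependent subset of B ∪ {e} contains e, as subsets of B are independent
    dependent-contains : ∀ {C e} → C ⊆ B ∪ ⁅ e ⁆ → ¬ Indep C → e ∈ C
    dependent-contains {C} {e} C⊆B+e C-dependent = decidable-stable (e ∈? C) λ e∉C →
      C-dependent (indep-⊆ (⊆-∪⁅⁆-avoiding C⊆B+e e∉C) (proj₁ B-basis))

    -- a codependent subset of ∁ B ∪ {b} contains b, as subsets of ∁ B avoid B
    codependent-contains : ∀ {D b} → D ⊆ ∁ B ∪ ⁅ b ⁆ → ¬ IndepDual M D → b ∈ D
    codependent-contains {D} {b} D⊆∁B+b D-codependent = decidable-stable (b ∈? D) λ b∉D →
      D-codependent (B , B-basis , Empty-unique λ (x , x∈D∩B) →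
        let (x∈D , x∈B) = x∈p∩q⁻ D B x∈D∩B
        in x∈∁p⇒x∉p (⊆-∪⁅⁆-avoiding D⊆∁B+b b∉D x∈D) x∈B)

    fundamental-circuit : ∀ e → e ∈ ∁ B →
      Σ (FundCircuit M B) λ C → MeetsExactlyAt (proj₁ (proj₁ C)) (∁ B) e
    fundamental-circuit e e∈∁B
      with minimal-subset (¬_ ∘ Indep) (¬? ∘ indep?) (B ∪ ⁅ e ⁆)
             (basis+e-dependent B-basis (x∈∁p⇒x∉p e∈∁B))
    ... | C , C⊆B+e , C-dependent , C-minimal =
      ((C , C-dependent , C-minimal) , e , x∈∁p⇒x∉p e∈∁B , C⊆B+e) ,
      meets-exactly (dependent-contains C⊆B+e C-dependent) C⊆B+e (λ _ → x∈∁p⇒x∉p)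

    fundamental-cocircuit : ∀ b → b ∈ B →
      Σ (FundCocircuit M B) λ D → MeetsExactlyAt (proj₁ (proj₁ D)) B b
    fundamental-cocircuit b b∈B
      with minimal-subset (¬_ ∘ IndepDual M) (¬? ∘ indepDual?) (∁ B ∪ ⁅ b ⁆)
             (basis-complement+b-codependent B-basis b∈B)
    ... | D , D⊆∁B+b , D-codependent , D-minimal =
      ((D , D-codependent , D-minimal) , b , b∈B , D⊆∁B+b) ,
      meets-exactly (codependent-contains D⊆∁B+b D-codependent) D⊆∁B+b (λ _ → x∈p⇒x∉∁p)

module SignedRows {c ℓ} (K : Field c ℓ) where
  open Field K hiding (zero)
  open Signed K using (signedRow)
  open LinearAlgebra K using (Isolated)
  open import Algebra.Properties.Ring ring using (-1*x≈-x; -‿involutive)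

  signedRow-outside : ∀ {n} (S : Subset n) σ j → j ∉ S → signedRow S σ j ≈ 0#
  signedRow-outside S σ j j∉S with lookup S j in S[j]
  ... | Bool.true  = ⊥-elim (j∉S (lookup⇒[]= j S S[j]))
  ... | Bool.false = refl

  sign² : ∀ b → (Bool.if b then - 1# else 1#) * (Bool.if b then - 1# else 1#) ≈ 1#
  sign² Bool.true  = trans (-1*x≈-x (- 1#)) (-‿involutive 1#)
  sign² Bool.false = *-identityˡ 1#

  signedRow-square : ∀ {n} (S : Subset n) σ j → j ∈ S → signedRow S σ j * signedRow S σ j ≈ 1#
  signedRow-square S σ j j∈S rewrite []=⇒lookup j∈S = sign² (σ j)

  signedRow-isolated : ∀ {n} {S Z : Subset n} {e σ} →
    MeetsExactlyAt S Z e → Isolated (signedRow S σ) Z e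
  signedRow-isolated {S = S} {σ = σ} (e∈S , avoids) =
    signedRow-square S σ _ e∈S , λ j j∈Z j≢e → signedRow-outside S σ j (avoids j j∈Z j≢e)

module Ranks {c ℓ} (K : Field c ℓ) {n} (M : Matroid n)
             (indep? : ∀ X → Dec (Matroid.Indep M X)) {B : Subset n} (B-basis : IsBasis M B)
             (σ : Signed.Signing K M) (τ : Signed.CoSigning K M)
             (compatible : Signed.Compatible K M σ τ) where
  open Field K using (trans)
  open Signed K
  open LinearAlgebra K using (orthogonal-rank; dot-comm)
  open SignedRows K using (signedRow-isolated)
  open Fundamental M indep? using (fundamental-circuit; fundamental-cocircuit)

  circuit-rank : ∀ {a} {I : Set a} {t} (C : I → Circuit M) → ∣ ∁ B ∣ ≡ t →
    (∀ e → e ∈ ∁ B → Σ I λ i → MeetsExactlyAt (proj₁ (C i)) (∁ B) e) →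
    HasRank (circMatrix M σ ∘ C) t
  circuit-rank C ∣∁B∣≡t pivots =
    orthogonal-rank (circMatrix M σ ∘ C) (cocircMatrix M τ) B (∁ B) (λ _ → x∉p⇒x∈∁p) ∣∁B∣≡t
      (compatible ∘ C)
      (λ e e∈∁B → let (i , meets) = pivots e e∈∁B in i , signedRow-isolated meets)
      (λ s s∈B → let (D , meets) = fundamental-cocircuit B-basis s s∈B
                  in proj₁ D , signedRow-isolated meets)

  cocircuit-rank : ∀ {a} {I : Set a} {t} (D : I → Cocircuit M) → ∣ B ∣ ≡ t →
    (∀ b → b ∈ B → Σ I λ i → MeetsExactlyAt (proj₁ (D i)) B b) →
    HasRank (cocircMatrix M τ ∘ D) t
  cocircuit-rank D ∣B∣≡t pivots =
    orthogonal-rank (cocircMatrix M τ ∘ D) (circMatrix M σ) (∁ B) B (λ _ → x∉∁p⇒x∈p) ∣B∣≡t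
      (λ i C → trans (dot-comm (cocircMatrix M τ (D i)) (circMatrix M σ C)) (compatible C (D i)))
      (λ b b∈B → let (i , meets) = pivots b b∈B in i , signedRow-isolated meets)
      (λ s s∈∁B → let (C , meets) = fundamental-circuit B-basis s s∈∁B
                   in proj₁ C , signedRow-isolated meets)

proposition3p3 : ∀ {c ℓ : Level} (K : Field c ℓ) (n r : ℕ) (M : Matroid n) →
    IsRegular M → HasMatroidRank M r →
    (B : Subset n) → IsBasis M B →
    (σ : Signed.Signing K M) (τ : Signed.CoSigning K M) →
    Signed.Compatible K M σ τ →
    (Signed.HasRank K (Signed.fundCircMatrix K M σ B) (n ∸ r)
      × Signed.HasRank K (Signed.circMatrix K M σ) (n ∸ r))
    × (Signed.HasRank K (Signed.fundCocircMatrix K M τ B) r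
      × Signed.HasRank K (Signed.cocircMatrix K M τ) r)
proposition3p3 K n r M regular rank B B-basis σ τ compatible =
  ( circuit-rank proj₁ ∣∁B∣≡n∸r (fundamental-circuit B-basis)
  , circuit-rank id ∣∁B∣≡n∸r (λ e → map proj₁ id ∘ fundamental-circuit B-basis e) )
  , ( cocircuit-rank proj₁ ∣B∣≡r (fundamental-cocircuit B-basis)
    , cocircuit-rank id ∣B∣≡r (λ b → map proj₁ id ∘ fundamental-cocircuit B-basis b) )
  where
  indep? : ∀ X → Dec (Matroid.Indep M X)
  indep? = regular⇒indep? M regular
  open Ranks K M indep? B-basis σ τ compatible
  open Fundamental M indep? using (fundamental-circuit; fundamental-cocircuit)
  ∣B∣≡r : ∣ B ∣ ≡ r
  ∣B∣≡r = Bases.basis-card M B-basis rank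
  ∣∁B∣≡n∸r : ∣ ∁ B ∣ ≡ n ∸ r
  ∣∁B∣≡n∸r = ≡.trans (∣∁p∣≡n∸∣p∣ B) (≡.cong (n ∸_) ∣B∣≡r)
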